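{- Let $S$ be a finite nonempty set, $B$ the nonempty integral base-polyhedron defined by an integer-valued supermodular function $p$, $b$ its complementary submodular function, and $\dot B=B\cap\mathbb{Z}^S$. For $c,d\in\mathbb{Z}^S$ with $c\le d$, letting $[c,d]_{\mathbb{Z}}=\{y\in\mathbb{Z}^S: c(s)\le y(s)\le d(s)\ \forall s\in S\}$, $$\min\{\|x-y\|_1 : x\in\dot B,\ y\in[c,d]_{\mathbb{Z}}\}=\max\{p(X)-b(Y)-\widetilde d(X)+\widetilde c(Y) : X,Y\subseteq S,\ X\cap Y=\emptyset\}.$$
   Context: $p:2^S\to\mathbb{Z}\cup\{ -\infty\}$ is supermodular ($p(X)+p(Y)\le p(X\cap Y)+p(X\cup Y)$ when the left terms are finite) with $p(\emptyset)=0$, $p(S)$ finite; $B=\{x\in\mathbb{R}^S:\widetilde x(S)=p(S),\ \widetilde x(Z)\ge p(Z)\ \forall Z\subset S\}$ where $\widetilde x(Z)=\sum_{v\in Z}x(v)$. The complementary function is $b(X)=p(S)-p(S\setminus X)$. $\|z\|_1=\sum_{s}|z(s)|$. -}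

module Defs where

open import Data.Nat using (ℕ; suc)
open import Data.Bool using (true; false)
open import Data.Fin using (Fin; zero; suc)
open import Data.Fin.Subset using (Subset; _∩_; _∪_; ∁; ⊥; ⊤; Empty)
open import Data.Vec using ([]; _∷_)
open import Data.Integer using (ℤ; _+_; _-_; _≤_; ∣_∣; +_; 0ℤ)
open import Data.Maybe using (Maybe; just; nothing)
open import Data.Product using (Σ; ∃; _×_; _,_)
open import Relation.Binary.PropositionalEquality using (_≡_)

-- ℤ ∪ {-∞}: nothing represents -∞, just a represents the finite value a.
ℤ-∞ : Set
ℤ-∞ = Maybe ℤ

sumOver : ∀ {n} → (Fin n → ℤ) → Subset n → ℤ
sumOver {ℕ.zero} x [] = 0ℤ
sumOver {suc n} x (true ∷ Z) = x zero + sumOver (λ i → x (suc i)) Z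
sumOver {suc n} x (false ∷ Z) = sumOver (λ i → x (suc i)) Z

dist1 : ∀ {n} → (Fin n → ℤ) → (Fin n → ℤ) → ℤ
dist1 x y = sumOver (λ i → + ∣ x i - y i ∣) ⊤

Supermodular : ∀ {n} → (Subset n → ℤ-∞) → Set
Supermodular {n} p = ∀ (X Y : Subset n) (a b : ℤ) → p X ≡ just a → p Y ≡ just b →
  Σ ℤ λ c → Σ ℤ λ d → p (X ∩ Y) ≡ just c × p (X ∪ Y) ≡ just d × (a + b) ≤ (c + d)

-- Integer points of the base polyhedron B(p), where p(S) = pS.
InBase : ∀ {n} → (Subset n → ℤ-∞) → ℤ → (Fin n → ℤ) → Set
InBase {n} p pS x = sumOver x ⊤ ≡ pS × (∀ (Z : Subset n) (a : ℤ) → p Z ≡ just a → a ≤ sumOver x Z)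

InBox : ∀ {n} → (Fin n → ℤ) → (Fin n → ℤ) → (Fin n → ℤ) → Set
InBox c d y = ∀ i → (c i ≤ y i) × (y i ≤ d i)

IsPrimalValue : ∀ {n} → (Subset n → ℤ-∞) → ℤ → (Fin n → ℤ) → (Fin n → ℤ) → ℤ → Set
IsPrimalValue p pS c d m = Σ _ λ x → Σ _ λ y → InBase p pS x × InBox c d y × dist1 x y ≡ m

-- The objective p(X) - b(Y) - d̃(X) + c̃(Y) with b(Y) = p(S) - p(S∖Y),
-- for disjoint X, Y where it is finite (p(X) = a, p(S∖Y) = e), has value m.
-- When p(X) = -∞ or p(S∖Y) = -∞ the objective is -∞ and irrelevant for max.
IsDualValue : ∀ {n} → (Subset n → ℤ-∞) → ℤ → (Fin n → ℤ) → (Fin n → ℤ) → ℤ → Set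
IsDualValue {n} p pS c d m = Σ (Subset n) λ X → Σ (Subset n) λ Y → Σ ℤ λ a → Σ ℤ λ e →
  Empty (X ∩ Y) × p X ≡ just a × p (∁ Y) ≡ just e ×
  ((a - (pS - e)) - sumOver d X) + sumOver c Y ≡ m

-- For x ∈ Ḃ let nearest x be the point of the box [c,d] closest to x
-- coordinatewise and excess x = ‖x − nearest x‖₁.  The proof is a
-- primal–dual local search.
--
--  * Weak duality: for x ∈ Ḃ, y ∈ [c,d] and disjoint X, Y with p(X), p(S∖Y)
--    finite, the dual objective is at most ‖x − y‖₁; coordinatewise it is
--    bounded by Σ_X (x − d) + Σ_Y (c − x).
--  * Exchange: if no x-tight set contains s but not t, moving one unit of x
--    from s to t stays in Ḃ.  Such a move strictly lowers the excess when it
--    goes from above d to below d, or from above c to below c.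
--  * Tight sets of x ∈ Ḃ form a lattice (supermodularity + modularity of x̃).
--    In a lattice family, pairwise separation of two sets of points gives a
--    single separating member.  So at a point where no improving move exists,
--    there are tight X ⊇ {x > d} avoiding {x < d} and tight W ⊇ {x > c}
--    avoiding {x < c}; with U = X ∪ W the pair (X, S∖U) has value excess x.
--  * Descent: the excess is a natural number that every improving move
--    lowers, so by well-founded induction a point without improving moves is
--    reached from any x ∈ Ḃ.  Its excess is then both the primal minimum and
--    the dual maximum.
module Submission where

open import Defs
open import Data.Bool using (true; false; not; if_then_else_)
open import Data.Bool.Properties using (not-involutive)
open import Data.Empty using (⊥-elim)
open import Data.Fin using (Fin; zero; suc)
import Data.Fin.Properties as FinP
open import Data.Fin.Subset using (Subset; _∈_; _∉_; _∩_; _∪_; ∁; ⊥; ⊤; Empty)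
open import Data.Fin.Subset.Properties
  using (_∈?_; anySubset?; ∈⊤; ∉⊥; p⊆p∪q; q⊆p∪q; p∩q⊆p; p∩q⊆q; x∈p∩q⁺; x∈p∪q⁻; x∈p∪q⁺;
         x∈p∩q⁻; x∉∁p⇒x∈p; x∈∁p⇒x∉p)
open import Data.Integer
  using (ℤ; _+_; _-_; -_; _≤_; _<_; ∣_∣; +_; -[1+_]; 0ℤ; 1ℤ; -1ℤ; _⊓_; _⊔_; +≤+; -≤+; +<+)
open import Data.Integer.Properties
  using (≤-refl; ≤-reflexive; ≤-trans; ≤-antisym; <-≤-trans; <⇒≤; <-irrefl; <-asym;
         ≮⇒≥; _<?_; +-mono-≤; +-monoˡ-≤; +-mono-<-≤; +-mono-≤-<; +-identityˡ; +-identityʳ;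
         +-assoc; +-inverseʳ; neg-mono-≤; +-monoʳ-≤; i<j⇒suc[i]≤j; suc[i]≤j⇒i<j;
         0≤i⇒+∣i∣≡i; i≤j⇒0≤j-i; ∣i-j∣≡∣j-i∣; i≤j⇒i⊓j≡i; i≥j⇒i⊓j≡j; i≤j⇒i⊔j≡j;
         i≥j⇒i⊔j≡i; i≤i⊔j; i⊓j≤j; ⊔-lub; +-comm; i<j⇒i≤pred[j]; _≤?_; i-j≤i; ≰⇒>; i≤i+j;
         ≤∧≢⇒<; _≟_; module ≤-Reasoning)
open import Data.Integer.Tactic.RingSolver using (solve-∀)
open import Data.List using (List; []; _∷_; allFin)
open import Data.List.Membership.Propositional using () renaming (_∈_ to _∈ₗ_)
open import Data.List.Membership.Propositional.Properties using (∈-allFin)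
import Data.List.Relation.Unary.Any as Any
open import Data.Maybe using (just)
open import Data.Maybe.Properties using (≡-dec)
open import Data.Nat using (ℕ; suc; z≤n) renaming (_<_ to _<ℕ_)
open import Data.Nat.Induction using (<-wellFounded)
open import Data.Product using (Σ; ∃₂; _×_; _,_; proj₁; proj₂)
open import Data.Sum using (_⊎_; inj₁; inj₂; [_,_])
open import Data.Vec using ([]; _∷_; lookup; here; there)
open import Data.Vec.Properties using (map-∘; map-cong; map-id; []=⇒lookup; lookup⇒[]=)
open import Function using (_∘_; _on_)
open import Induction.WellFounded using (Acc; acc)
open import Relation.Binary.Construct.On using (wellFounded)
open import Relation.Binary.PropositionalEquality
  using (_≡_; _≢_; refl; sym; trans; cong; cong₂; subst; module ≡-Reasoning)
open import Relation.Nullary using (Dec; yes; no; ¬_)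
open import Relation.Nullary.Decidable using (_×-dec_; ¬?; decidable-stable)
open import Relation.Unary using (Decidable)

≤-sum-squeeze : ∀ {a b u v : ℤ} → a ≤ u → b ≤ v → u + v ≤ a + b → a ≡ u × b ≡ v
≤-sum-squeeze a≤u b≤v sum≤ =
  ≤-antisym a≤u (≮⇒≥ λ a<u → <-irrefl refl (<-≤-trans (+-mono-<-≤ a<u b≤v) sum≤)) ,
  ≤-antisym b≤v (≮⇒≥ λ b<v → <-irrefl refl (<-≤-trans (+-mono-≤-< a≤u b<v) sum≤))

<⇒≤-1 : ∀ {a b : ℤ} → a < b → a ≤ b - 1ℤ
<⇒≤-1 {a} {b} a<b = subst (a ≤_) (+-comm -1ℤ b) (i<j⇒i≤pred[j] a<b)

<⇒+1≤ : ∀ {a b : ℤ} → a < b → a + 1ℤ ≤ b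
<⇒+1≤ {a} a<b = subst (_≤ _) (+-comm 1ℤ a) (i<j⇒suc[i]≤j a<b)

-1< : ∀ (a : ℤ) → a - 1ℤ < a
-1< a = suc[i]≤j⇒i<j (≤-reflexive (cancel a))
  where cancel : ∀ a → 1ℤ + (a - 1ℤ) ≡ a
        cancel = solve-∀

i≤+∣i∣ : ∀ (i : ℤ) → i ≤ + ∣ i ∣
i≤+∣i∣ (+ _)      = ≤-refl
i≤+∣i∣ -[1+ _ ]  = -≤+

∣∣-<-nonneg : ∀ {i j : ℤ} → 0ℤ ≤ i → i < j → ∣ i ∣ <ℕ ∣ j ∣
∣∣-<-nonneg (+≤+ _) (+<+ lt) = lt

sumOver-0 : ∀ {n} (Z : Subset n) → sumOver (λ _ → 0ℤ) Z ≡ 0ℤ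
sumOver-0 [] = refl
sumOver-0 (true ∷ Z) = trans (+-identityˡ _) (sumOver-0 Z)
sumOver-0 (false ∷ Z) = sumOver-0 Z

sumOver-+ : ∀ {n} (f g : Fin n → ℤ) (Z : Subset n) →
  sumOver (λ i → f i + g i) Z ≡ sumOver f Z + sumOver g Z
sumOver-+ f g [] = refl
sumOver-+ f g (true ∷ Z) =
  trans (cong (_+_ (f zero + g zero)) (sumOver-+ (f ∘ suc) (g ∘ suc) Z))
        (interchange (f zero) (g zero) (sumOver (f ∘ suc) Z) (sumOver (g ∘ suc) Z))
  where interchange : ∀ a b u v → (a + b) + (u + v) ≡ (a + u) + (b + v)
        interchange = solve-∀
sumOver-+ f g (false ∷ Z) = sumOver-+ (f ∘ suc) (g ∘ suc) Z

sumOver-diff : ∀ {n} (f g : Fin n → ℤ) (Z : Subset n) →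
  sumOver (λ i → f i - g i) Z ≡ sumOver f Z - sumOver g Z
sumOver-diff f g [] = refl
sumOver-diff f g (true ∷ Z) =
  trans (cong (_+_ (f zero - g zero)) (sumOver-diff (f ∘ suc) (g ∘ suc) Z))
        (interchange (f zero) (g zero) (sumOver (f ∘ suc) Z) (sumOver (g ∘ suc) Z))
  where interchange : ∀ a b u v → (a - b) + (u - v) ≡ (a + u) - (b + v)
        interchange = solve-∀
sumOver-diff f g (false ∷ Z) = sumOver-diff (f ∘ suc) (g ∘ suc) Z

sumOver-mono : ∀ {n} (f g : Fin n → ℤ) (Z : Subset n) →
  (∀ i → f i ≤ g i) → sumOver f Z ≤ sumOver g Z
sumOver-mono f g [] f≤g = ≤-refl
sumOver-mono f g (true ∷ Z) f≤g = +-mono-≤ (f≤g zero) (sumOver-mono (f ∘ suc) (g ∘ suc) Z (f≤g ∘ suc))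
sumOver-mono f g (false ∷ Z) f≤g = sumOver-mono (f ∘ suc) (g ∘ suc) Z (f≤g ∘ suc)

sumOver-cong : ∀ {n} (f g : Fin n → ℤ) (Z : Subset n) →
  (∀ i → f i ≡ g i) → sumOver f Z ≡ sumOver g Z
sumOver-cong f g Z f≡g =
  ≤-antisym (sumOver-mono f g Z (≤-reflexive ∘ f≡g)) (sumOver-mono g f Z (≤-reflexive ∘ sym ∘ f≡g))

sumOver-< : ∀ {n} (f g : Fin n → ℤ) (u : Fin n) →
  (∀ i → f i ≤ g i) → f u < g u → sumOver f ⊤ < sumOver g ⊤
sumOver-< f g zero f≤g fu<gu = +-mono-<-≤ fu<gu (sumOver-mono (f ∘ suc) (g ∘ suc) ⊤ (f≤g ∘ suc))
sumOver-< f g (suc u) f≤g fu<gu = +-mono-≤-< (f≤g zero) (sumOver-< (f ∘ suc) (g ∘ suc) u (f≤g ∘ suc) fu<gu)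

sumOver-⊥ : ∀ {n} (f : Fin n → ℤ) → sumOver f ⊥ ≡ 0ℤ
sumOver-⊥ {ℕ.zero} f = refl
sumOver-⊥ {suc n} f = sumOver-⊥ (f ∘ suc)

sumOver-∁ : ∀ {n} (f : Fin n → ℤ) (Z : Subset n) → sumOver f Z + sumOver f (∁ Z) ≡ sumOver f ⊤
sumOver-∁ f [] = refl
sumOver-∁ f (true ∷ Z) =
  trans (+-assoc (f zero) (sumOver (f ∘ suc) Z) (sumOver (f ∘ suc) (∁ Z)))
        (cong (_+_ (f zero)) (sumOver-∁ (f ∘ suc) Z))
sumOver-∁ f (false ∷ Z) =
  trans (swap (f zero) (sumOver (f ∘ suc) Z) (sumOver (f ∘ suc) (∁ Z)))
        (cong (_+_ (f zero)) (sumOver-∁ (f ∘ suc) Z))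
  where swap : ∀ a u v → u + (a + v) ≡ a + (u + v)
        swap = solve-∀

modular : ∀ {n} (f : Fin n → ℤ) (A B : Subset n) →
  sumOver f (A ∩ B) + sumOver f (A ∪ B) ≡ sumOver f A + sumOver f B
modular f [] [] = refl
modular f (true ∷ A) (true ∷ B) = begin
  (a + S (A ∩ B)) + (a + S (A ∪ B)) ≡⟨ interchange a (S (A ∩ B)) a (S (A ∪ B)) ⟩
  (a + a) + (S (A ∩ B) + S (A ∪ B)) ≡⟨ cong (_+_ (a + a)) (modular (f ∘ suc) A B) ⟩
  (a + a) + (S A + S B)             ≡⟨ interchange a a (S A) (S B) ⟩
  (a + S A) + (a + S B)             ∎
  where open ≡-Reasoning
        a : ℤ
        a = f zero
        S : Subset _ → ℤ
        S = sumOver (f ∘ suc)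
        interchange : ∀ a b u v → (a + b) + (u + v) ≡ (a + u) + (b + v)
        interchange = solve-∀
modular f (true ∷ A) (false ∷ B) = begin
  S (A ∩ B) + (a + S (A ∪ B)) ≡⟨ swap a (S (A ∩ B)) (S (A ∪ B)) ⟩
  a + (S (A ∩ B) + S (A ∪ B)) ≡⟨ cong (_+_ a) (modular (f ∘ suc) A B) ⟩
  a + (S A + S B)             ≡⟨ sym (+-assoc a (S A) (S B)) ⟩
  (a + S A) + S B             ∎
  where open ≡-Reasoning
        a : ℤ
        a = f zero
        S : Subset _ → ℤ
        S = sumOver (f ∘ suc)
        swap : ∀ a u v → u + (a + v) ≡ a + (u + v)
        swap = solve-∀
modular f (false ∷ A) (true ∷ B) = begin
  S (A ∩ B) + (a + S (A ∪ B)) ≡⟨ swap a (S (A ∩ B)) (S (A ∪ B)) ⟩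
  a + (S (A ∩ B) + S (A ∪ B)) ≡⟨ cong (_+_ a) (modular (f ∘ suc) A B) ⟩
  a + (S A + S B)             ≡⟨ sym (swap a (S A) (S B)) ⟩
  S A + (a + S B)             ∎
  where open ≡-Reasoning
        a : ℤ
        a = f zero
        S : Subset _ → ℤ
        S = sumOver (f ∘ suc)
        swap : ∀ a u v → u + (a + v) ≡ a + (u + v)
        swap = solve-∀
modular f (false ∷ A) (false ∷ B) = modular (f ∘ suc) A B

tail-disjoint : ∀ {n} a b {X Y : Subset n} → Empty ((a ∷ X) ∩ (b ∷ Y)) → Empty (X ∩ Y)
tail-disjoint a b disjoint (i , i∈X∩Y) = disjoint (suc i , there i∈X∩Y)

∁-involutive : ∀ {n} (X : Subset n) → ∁ (∁ X) ≡ X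
∁-involutive X = trans (sym (map-∘ not not X)) (trans (map-cong not-involutive X) (map-id X))

piecewise : ∀ {n} → Subset n → Subset n → (Fin n → ℤ) → (Fin n → ℤ) → Fin n → ℤ
piecewise X Y f g i = if lookup X i then f i else (if lookup Y i then g i else 0ℤ)

sumOver-piecewise : ∀ {n} (X Y : Subset n) (f g : Fin n → ℤ) → Empty (X ∩ Y) →
  sumOver f X + sumOver g Y ≡ sumOver (piecewise X Y f g) ⊤
sumOver-piecewise [] [] f g disjoint = refl
sumOver-piecewise (true ∷ X) (true ∷ Y) f g disjoint = ⊥-elim (disjoint (zero , here))
sumOver-piecewise (true ∷ X) (false ∷ Y) f g disjoint =
  trans (+-assoc (f zero) (sumOver (f ∘ suc) X) (sumOver (g ∘ suc) Y))
        (cong (_+_ (f zero)) (sumOver-piecewise X Y (f ∘ suc) (g ∘ suc) (tail-disjoint true false disjoint)))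
sumOver-piecewise (false ∷ X) (true ∷ Y) f g disjoint =
  trans (swap (g zero) (sumOver (f ∘ suc) X) (sumOver (g ∘ suc) Y))
        (cong (_+_ (g zero)) (sumOver-piecewise X Y (f ∘ suc) (g ∘ suc) (tail-disjoint false true disjoint)))
  where swap : ∀ a u v → u + (a + v) ≡ a + (u + v)
        swap = solve-∀
sumOver-piecewise (false ∷ X) (false ∷ Y) f g disjoint =
  trans (sumOver-piecewise X Y (f ∘ suc) (g ∘ suc) (tail-disjoint false false disjoint)) (sym (+-identityˡ _))

piecewise-view : ∀ {n} (X Y : Subset n) (f g : Fin n → ℤ) (i : Fin n) →
    (i ∈ X × piecewise X Y f g i ≡ f i)
  ⊎ (i ∈ Y × piecewise X Y f g i ≡ g i)
  ⊎ (i ∉ X × i ∉ Y × piecewise X Y f g i ≡ 0ℤ)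
piecewise-view X Y f g i with lookup X i in i∈?X | lookup Y i in i∈?Y
... | true  | _     = inj₁ (lookup⇒[]= i X i∈?X , refl)
... | false | true  = inj₂ (inj₁ (lookup⇒[]= i Y i∈?Y , refl))
... | false | false = inj₂ (inj₂ (absent X i∈?X , absent Y i∈?Y , refl))
  where absent : ∀ Z → lookup Z i ≡ false → i ∉ Z
        absent Z outside i∈Z with () ← trans (sym ([]=⇒lookup i∈Z)) outside

χ : ∀ {n} → Fin n → Fin n → ℤ
χ zero    zero    = 1ℤ
χ zero    (suc _) = 0ℤ
χ (suc _) zero    = 0ℤ
χ (suc s) (suc i) = χ s i

χ-same : ∀ {n} (s : Fin n) → χ s s ≡ 1ℤ
χ-same zero    = refl
χ-same (suc s) = χ-same s

χ-diff : ∀ {n} {s i : Fin n} → s ≢ i → χ s i ≡ 0ℤ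
χ-diff {s = zero}  {zero}  s≢i = ⊥-elim (s≢i refl)
χ-diff {s = zero}  {suc i} s≢i = refl
χ-diff {s = suc s} {zero}  s≢i = refl
χ-diff {s = suc s} {suc i} s≢i = χ-diff (s≢i ∘ cong suc)

sumOver-χ-∈ : ∀ {n} {s : Fin n} {Z : Subset n} → s ∈ Z → sumOver (χ s) Z ≡ 1ℤ
sumOver-χ-∈ {Z = true ∷ Z} here = cong (_+_ 1ℤ) (sumOver-0 Z)
sumOver-χ-∈ {Z = true ∷ Z} (there s∈Z) = trans (+-identityˡ _) (sumOver-χ-∈ s∈Z)
sumOver-χ-∈ {Z = false ∷ Z} (there s∈Z) = sumOver-χ-∈ s∈Z

sumOver-χ-∉ : ∀ {n} {s : Fin n} {Z : Subset n} → s ∉ Z → sumOver (χ s) Z ≡ 0ℤ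
sumOver-χ-∉ {s = zero}  {true ∷ Z}  s∉Z = ⊥-elim (s∉Z here)
sumOver-χ-∉ {s = zero}  {false ∷ Z} s∉Z = sumOver-0 Z
sumOver-χ-∉ {s = suc s} {true ∷ Z}  s∉Z = trans (+-identityˡ _) (sumOver-χ-∉ (s∉Z ∘ there))
sumOver-χ-∉ {s = suc s} {false ∷ Z} s∉Z = sumOver-χ-∉ (s∉Z ∘ there)

transfer : ∀ {n} → (Fin n → ℤ) → Fin n → Fin n → Fin n → ℤ
transfer x s t i = x i - χ s i + χ t i

sumOver-transfer : ∀ {n} (x : Fin n → ℤ) (s t : Fin n) (Z : Subset n) →
  sumOver (transfer x s t) Z ≡ sumOver x Z - sumOver (χ s) Z + sumOver (χ t) Z
sumOver-transfer x s t Z =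
  trans (sumOver-+ (λ i → x i - χ s i) (χ t) Z) (cong (_+ sumOver (χ t) Z) (sumOver-diff x (χ s) Z))

transfer-source : ∀ {n} (x : Fin n → ℤ) {s t : Fin n} → s ≢ t → transfer x s t s ≡ x s - 1ℤ
transfer-source x {s} {t} s≢t rewrite χ-same s | χ-diff (s≢t ∘ sym) = +-identityʳ (x s - 1ℤ)

transfer-target : ∀ {n} (x : Fin n → ℤ) {s t : Fin n} → s ≢ t → transfer x s t t ≡ x t + 1ℤ
transfer-target x {s} {t} s≢t rewrite χ-same t | χ-diff s≢t = cong (_+ 1ℤ) (+-identityʳ (x t))

transfer-other : ∀ {n} (x : Fin n → ℤ) {s t i : Fin n} → i ≢ s → i ≢ t → transfer x s t i ≡ x i
transfer-other x {i = i} i≢s i≢t rewrite χ-diff (i≢s ∘ sym) | χ-diff (i≢t ∘ sym) =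
  trans (+-identityʳ _) (+-identityʳ (x i))

clamp : ℤ → ℤ → ℤ → ℤ
clamp c d v = c ⊔ (v ⊓ d)

gap : ℤ → ℤ → ℤ → ℤ
gap c d v = + ∣ v - clamp c d v ∣

module _ {c d : ℤ} (c≤d : c ≤ d) where

  clamp-in : ∀ v → c ≤ clamp c d v × clamp c d v ≤ d
  clamp-in v = i≤i⊔j c (v ⊓ d) , ⊔-lub c≤d (i⊓j≤j v d)

  gap-above : ∀ {v} → d ≤ v → gap c d v ≡ v - d
  gap-above {v} d≤v rewrite i≥j⇒i⊓j≡j d≤v | i≤j⇒i⊔j≡j c≤d = 0≤i⇒+∣i∣≡i (i≤j⇒0≤j-i d≤v)

  gap-below : ∀ {v} → v ≤ c → gap c d v ≡ c - v
  gap-below {v} v≤c rewrite i≤j⇒i⊓j≡i (≤-trans v≤c c≤d) | i≥j⇒i⊔j≡i v≤c | ∣i-j∣≡∣j-i∣ v c =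
    0≤i⇒+∣i∣≡i (i≤j⇒0≤j-i v≤c)

  gap-inside : ∀ {v} → c ≤ v → v ≤ d → gap c d v ≡ 0ℤ
  gap-inside {v} c≤v v≤d rewrite i≤j⇒i⊓j≡i v≤d | i≤j⇒i⊔j≡j c≤v | +-inverseʳ v = refl

  gap-down-< : ∀ {v} → d < v → gap c d (v - 1ℤ) < gap c d v
  gap-down-< {v} d<v rewrite gap-above (<⇒≤-1 d<v) | gap-above (<⇒≤ d<v) =
    subst (_< v - d) (sym (shuffle v d)) (-1< (v - d))
    where shuffle : ∀ v d → v - 1ℤ - d ≡ v - d - 1ℤ
          shuffle = solve-∀

  gap-down-≤ : ∀ {v} → c < v → gap c d (v - 1ℤ) ≤ gap c d v
  gap-down-≤ {v} c<v with v ≤? d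
  ... | yes v≤d = ≤-reflexive (trans (gap-inside (<⇒≤-1 c<v) (≤-trans (i-j≤i v 1ℤ) v≤d))
                                     (sym (gap-inside (<⇒≤ c<v) v≤d)))
  ... | no v≰d = <⇒≤ (gap-down-< (≰⇒> v≰d))

  gap-up-< : ∀ {v} → v < c → gap c d (v + 1ℤ) < gap c d v
  gap-up-< {v} v<c rewrite gap-below (<⇒+1≤ v<c) | gap-below (<⇒≤ v<c) =
    subst (_< c - v) (sym (shuffle c v)) (-1< (c - v))
    where shuffle : ∀ c v → c - (v + 1ℤ) ≡ c - v - 1ℤ
          shuffle = solve-∀

  gap-up-≤ : ∀ {v} → v < d → gap c d (v + 1ℤ) ≤ gap c d v
  gap-up-≤ {v} v<d with c ≤? v
  ... | yes c≤v = ≤-reflexive (trans (gap-inside (≤-trans c≤v (i≤i+j v 1ℤ)) (<⇒+1≤ v<d))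
                                     (sym (gap-inside c≤v (<⇒≤ v<d))))
  ... | no c≰v = <⇒≤ (gap-up-< (≰⇒> c≰v))

module Merge {n : ℕ} (𝓕 : Subset n → Set) (_⊙_ : Subset n → Subset n → Subset n)
  (e : Subset n) (𝓕-e : 𝓕 e) (𝓕-⊙ : ∀ {A B} → 𝓕 A → 𝓕 B → 𝓕 (A ⊙ B))
  (G : Fin n → Subset n → Set)
  (G-⊙ˡ : ∀ {s A B} → G s A → G s (A ⊙ B)) (G-⊙ʳ : ∀ {s A B} → G s B → G s (A ⊙ B)) where

  merge : {P : Fin n → Set} → Decidable P → (∀ s → P s → Σ (Subset n) λ Z → 𝓕 Z × G s Z) →
    Σ (Subset n) λ Z → 𝓕 Z × (∀ s → P s → G s Z)
  merge {P} P? witness =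
    let (Z , 𝓕Z , GZ) = mergeList (allFin n) in Z , 𝓕Z , λ s → GZ (∈-allFin s)
    where
    mergeList : (ss : List (Fin n)) → Σ (Subset n) λ Z → 𝓕 Z × (∀ {s} → s ∈ₗ ss → P s → G s Z)
    mergeList [] = e , 𝓕-e , λ ()
    mergeList (s ∷ ss) with mergeList ss | P? s
    ... | Z , 𝓕Z , GZ | no ¬Ps = Z , 𝓕Z , λ where
      (Any.here refl) Ps → ⊥-elim (¬Ps Ps)
      (Any.there s′∈ss)  → GZ s′∈ss
    ... | Z , 𝓕Z , GZ | yes Ps with witness s Ps
    ...   | W , 𝓕W , GW = W ⊙ Z , 𝓕-⊙ 𝓕W 𝓕Z , λ where
      (Any.here refl) _    → G-⊙ˡ GW
      (Any.there s′∈ss) Ps′ → G-⊙ʳ (GZ s′∈ss Ps′)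

-- It is ⋂_{t ∈ Q} ⋃_{s ∈ P} Z_st.
separate : ∀ {n} (T : Subset n → Set) → T ⊥ → T ⊤ →
  (∀ {A B} → T A → T B → T (A ∩ B)) → (∀ {A B} → T A → T B → T (A ∪ B)) →
  {P Q : Fin n → Set} → Decidable P → Decidable Q →
  (∀ s t → P s → Q t → Σ (Subset n) λ Z → T Z × s ∈ Z × t ∉ Z) →
  Σ (Subset n) λ Z → T Z × (∀ s → P s → s ∈ Z) × (∀ t → Q t → t ∉ Z)
separate {n} T T-⊥ T-⊤ T-∩ T-∪ {P} {Q} P? Q? pairwise =
  let (Z , (TZ , P⊆Z) , Q∩Z≡∅) = intersection in Z , TZ , P⊆Z , Q∩Z≡∅
  where
  union : ∀ t → Q t → Σ (Subset n) λ Z → (T Z × (∀ s → P s → s ∈ Z)) × t ∉ Z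
  union t Qt =
    let (Z , (TZ , t∉Z) , P⊆Z) = Merge.merge
          (λ Z → T Z × t ∉ Z) _∪_ ⊥ (T-⊥ , ∉⊥)
          (λ {A} {B} (TA , t∉A) (TB , t∉B) → T-∪ TA TB , λ t∈A∪B → [ t∉A , t∉B ] (x∈p∪q⁻ A B t∈A∪B))
          (λ s Z → s ∈ Z) (λ {s} {A} {B} → p⊆p∪q B) (λ {s} {A} {B} → q⊆p∪q A B) P?
          (λ s Ps → let (Z , TZ , s∈Z , t∉Z) = pairwise s t Ps Qt in Z , (TZ , t∉Z) , s∈Z)
    in Z , (TZ , P⊆Z) , t∉Z

  intersection : Σ (Subset n) λ Z → (T Z × (∀ s → P s → s ∈ Z)) × (∀ t → Q t → t ∉ Z)
  intersection = Merge.merge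
    (λ Z → T Z × (∀ s → P s → s ∈ Z)) _∩_ ⊤ (T-⊤ , λ _ _ → ∈⊤)
    (λ (TA , P⊆A) (TB , P⊆B) → T-∩ TA TB , λ s Ps → x∈p∩q⁺ (P⊆A s Ps , P⊆B s Ps))
    (λ t Z → t ∉ Z) (λ {t} {A} {B} t∉A t∈A∩B → t∉A (p∩q⊆p A B t∈A∩B))
    (λ {t} {A} {B} t∉B t∈A∩B → t∉B (p∩q⊆q A B t∈A∩B)) Q? union

module BasePolyhedron {n : ℕ} (p : Subset n → ℤ-∞) (pS : ℤ) (supermodular : Supermodular p)
  (p⊥ : p ⊥ ≡ just 0ℤ) (p⊤ : p ⊤ ≡ just pS) where

  Base : (Fin n → ℤ) → Set
  Base = InBase p pS

  Tight : (Fin n → ℤ) → Subset n → Set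
  Tight x Z = p Z ≡ just (sumOver x Z)

  tight? : ∀ x Z → Dec (Tight x Z)
  tight? x Z = ≡-dec _≟_ (p Z) (just (sumOver x Z))

  tight-⊥ : ∀ x → Tight x ⊥
  tight-⊥ x = trans p⊥ (cong just (sym (sumOver-⊥ x)))

  tight-⊤ : ∀ {x} → Base x → Tight x ⊤
  tight-⊤ (total , _) = trans p⊤ (cong just (sym total))

  -- For x ∈ B the tight sets form a lattice: with A, B tight,
  --   x̃(A ∩ B) + x̃(A ∪ B) = p(A) + p(B) ≤ p(A ∩ B) + p(A ∪ B),
  -- while p ≤ x̃ on both sets, so both are tight.
  tight-∩∪ : ∀ {x A B} → Base x → Tight x A → Tight x B → Tight x (A ∩ B) × Tight x (A ∪ B)
  tight-∩∪ {x} {A} {B} (_ , lower) tight-A tight-B =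
    let (a , b , p∩ , p∪ , super) = supermodular A B _ _ tight-A tight-B
        (a≡ , b≡) = ≤-sum-squeeze (lower (A ∩ B) a p∩) (lower (A ∪ B) b p∪)
                                   (≤-trans (≤-reflexive (modular x A B)) super)
    in trans p∩ (cong just a≡) , trans p∪ (cong just b≡)

  Separates : (Fin n → ℤ) → Fin n → Fin n → Set
  Separates x s t = Σ (Subset n) λ Z → Tight x Z × s ∈ Z × t ∉ Z

  separates? : ∀ x s t → Dec (Separates x s t)
  separates? x s t = anySubset? λ Z → tight? x Z ×-dec (s ∈? Z ×-dec ¬? (t ∈? Z))

  -- Exchange: if no tight set contains s but not t, moving a unit from s to t
  -- keeps x in B; only sets containing s but not t lose a unit, and they
  -- were not tight.
  transfer-base : ∀ {x s t} → Base x → ¬ Separates x s t → Base (transfer x s t)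
  transfer-base {x} {s} {t} (total , lower) ¬sep = total′ , lower′
    where
    open ≤-Reasoning
    shifted : ∀ Z {σ τ} → sumOver (χ s) Z ≡ σ → sumOver (χ t) Z ≡ τ →
      sumOver (transfer x s t) Z ≡ sumOver x Z - σ + τ
    shifted Z refl refl = sumOver-transfer x s t Z
    -1+1 : ∀ a → a - 1ℤ + 1ℤ ≡ a
    -1+1 = solve-∀
    -0+0 : ∀ a → a - 0ℤ + 0ℤ ≡ a
    -0+0 = solve-∀
    -0+1 : ∀ a → a - 0ℤ + 1ℤ ≡ a + 1ℤ
    -0+1 = solve-∀
    -1+0 : ∀ a → a - 1ℤ + 0ℤ ≡ a - 1ℤ
    -1+0 = solve-∀

    total′ : sumOver (transfer x s t) ⊤ ≡ pS
    total′ = trans (shifted ⊤ (sumOver-χ-∈ (∈⊤ {x = s})) (sumOver-χ-∈ (∈⊤ {x = t})))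
                   (trans (-1+1 (sumOver x ⊤)) total)

    lower′ : ∀ Z a → p Z ≡ just a → a ≤ sumOver (transfer x s t) Z
    lower′ Z a pZ with s ∈? Z | t ∈? Z
    ... | yes s∈Z | yes t∈Z = begin
      a                            ≤⟨ lower Z a pZ ⟩
      sumOver x Z                  ≡⟨ sym (-1+1 (sumOver x Z)) ⟩
      sumOver x Z - 1ℤ + 1ℤ        ≡⟨ sym (shifted Z (sumOver-χ-∈ s∈Z) (sumOver-χ-∈ t∈Z)) ⟩
      sumOver (transfer x s t) Z   ∎
    ... | no s∉Z | no t∉Z = begin
      a                            ≤⟨ lower Z a pZ ⟩
      sumOver x Z                  ≡⟨ sym (-0+0 (sumOver x Z)) ⟩
      sumOver x Z - 0ℤ + 0ℤ        ≡⟨ sym (shifted Z (sumOver-χ-∉ s∉Z) (sumOver-χ-∉ t∉Z)) ⟩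
      sumOver (transfer x s t) Z   ∎
    ... | no s∉Z | yes t∈Z = begin
      a                            ≤⟨ lower Z a pZ ⟩
      sumOver x Z                  ≤⟨ i≤i+j _ 1ℤ ⟩
      sumOver x Z + 1ℤ             ≡⟨ sym (-0+1 (sumOver x Z)) ⟩
      sumOver x Z - 0ℤ + 1ℤ        ≡⟨ sym (shifted Z (sumOver-χ-∉ s∉Z) (sumOver-χ-∈ t∈Z)) ⟩
      sumOver (transfer x s t) Z   ∎
    ... | yes s∈Z | no t∉Z = begin
      a                            ≤⟨ <⇒≤-1 (≤∧≢⇒< (lower Z a pZ) not-tight) ⟩
      sumOver x Z - 1ℤ             ≡⟨ sym (-1+0 (sumOver x Z)) ⟩
      sumOver x Z - 1ℤ + 0ℤ        ≡⟨ sym (shifted Z (sumOver-χ-∈ s∈Z) (sumOver-χ-∉ t∉Z)) ⟩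
      sumOver (transfer x s t) Z   ∎
      where not-tight : a ≢ sumOver x Z
            not-tight a≡x̃Z = ¬sep (Z , trans pZ (cong just a≡x̃Z) , s∈Z , t∉Z)

  Stuck : (Fin n → ℤ) → (Fin n → ℤ) → Set
  Stuck l x = ∀ s t → l s < x s → x t < l t → Separates x s t

  Improvable : (Fin n → ℤ) → (Fin n → ℤ) → Set
  Improvable l x = ∃₂ λ s t → l s < x s × x t < l t × ¬ Separates x s t

  improvable-or-stuck : ∀ l x → Improvable l x ⊎ Stuck l x
  improvable-or-stuck l x
    with FinP.any? (λ s → FinP.any? (λ t → (l s <? x s) ×-dec ((x t <? l t) ×-dec ¬? (separates? x s t))))
  ... | yes (s , t , move) = inj₁ (s , t , move)
  ... | no ¬move = inj₂ λ s t ls<xs xt<lt →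
    decidable-stable (separates? x s t) λ ¬sep → ¬move (s , t , ls<xs , xt<lt , ¬sep)

  module Box (c d : Fin n → ℤ) (c≤d : ∀ i → c i ≤ d i) where

    G : Fin n → ℤ → ℤ
    G i = gap (c i) (d i)

    nearest : (Fin n → ℤ) → Fin n → ℤ
    nearest x i = clamp (c i) (d i) (x i)

    nearest-in-box : ∀ x → InBox c d (nearest x)
    nearest-in-box x i = clamp-in (c≤d i) (x i)

    excess : (Fin n → ℤ) → ℤ
    excess x = dist1 x (nearest x)

    excess-nonneg : ∀ x → 0ℤ ≤ excess x
    excess-nonneg x =
      ≤-trans (≤-reflexive (sym (sumOver-0 {n} ⊤))) (sumOver-mono _ (λ i → G i (x i)) ⊤ λ _ → +≤+ z≤n)

    transfer-pointwise : ∀ {x s t} → s ≢ t →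
      G s (x s - 1ℤ) ≤ G s (x s) → G t (x t + 1ℤ) ≤ G t (x t) →
      ∀ i → G i (transfer x s t i) ≤ G i (x i)
    transfer-pointwise {x} {s} {t} s≢t at-s at-t i with i FinP.≟ s | i FinP.≟ t
    ... | yes refl | _        = subst (λ v → G i v ≤ G i (x i)) (sym (transfer-source x s≢t)) at-s
    ... | no _     | yes refl = subst (λ v → G i v ≤ G i (x i)) (sym (transfer-target x s≢t)) at-t
    ... | no i≢s   | no i≢t   = ≤-reflexive (cong (G i) (transfer-other x i≢s i≢t))

    excess-transfer : ∀ {x s t} → s ≢ t →
        (G s (x s - 1ℤ) < G s (x s) × G t (x t + 1ℤ) ≤ G t (x t))
      ⊎ (G s (x s - 1ℤ) ≤ G s (x s) × G t (x t + 1ℤ) < G t (x t)) →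
      excess (transfer x s t) < excess x
    excess-transfer {x} {s} {t} s≢t (inj₁ (at-s , at-t)) =
      sumOver-< _ _ s (transfer-pointwise {x} s≢t (<⇒≤ at-s) at-t)
        (subst (λ v → G s v < G s (x s)) (sym (transfer-source x s≢t)) at-s)
    excess-transfer {x} {s} {t} s≢t (inj₂ (at-s , at-t)) =
      sumOver-< _ _ t (transfer-pointwise {x} s≢t at-s (<⇒≤ at-t))
        (subst (λ v → G t v < G t (x t)) (sym (transfer-target x s≢t)) at-t)

    Improvement : (Fin n → ℤ) → Set
    Improvement x = Σ (Fin n → ℤ) λ x′ → Base x′ × excess x′ < excess x

    improve-above : ∀ {x} → Base x → Improvable d x → Improvement x
    improve-above {x} x∈B (s , t , ds<xs , xt<dt , ¬sep) =
      transfer x s t , transfer-base x∈B ¬sep ,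
      excess-transfer {x} s≢t (inj₁ (gap-down-< (c≤d s) ds<xs , gap-up-≤ (c≤d t) xt<dt))
      where s≢t : s ≢ t
            s≢t refl = <-asym ds<xs xt<dt

    improve-below : ∀ {x} → Base x → Improvable c x → Improvement x
    improve-below {x} x∈B (s , t , cs<xs , xt<ct , ¬sep) =
      transfer x s t , transfer-base x∈B ¬sep ,
      excess-transfer {x} s≢t (inj₂ (gap-down-≤ (c≤d s) cs<xs , gap-up-< (c≤d t) xt<ct))
      where s≢t : s ≢ t
            s≢t refl = <-asym cs<xs xt<ct

    improve-or-stuck : ∀ {x} → Base x → Improvement x ⊎ (Stuck d x × Stuck c x)
    improve-or-stuck {x} x∈B with improvable-or-stuck d x | improvable-or-stuck c x
    ... | inj₁ move    | _            = inj₁ (improve-above x∈B move)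
    ... | inj₂ _       | inj₁ move    = inj₁ (improve-below x∈B move)
    ... | inj₂ stuck-d | inj₂ stuck-c = inj₂ (stuck-d , stuck-c)

    -- Local search terminates, since the excess is a natural number.
    descent : ∀ {x} → Base x → Σ (Fin n → ℤ) λ x* → Base x* × Stuck d x* × Stuck c x*
    descent {x} x∈B = search x∈B (wellFounded (∣_∣ ∘ excess) <-wellFounded x)
      where
      search : ∀ {x} → Base x → Acc (_<ℕ_ on (∣_∣ ∘ excess)) x →
        Σ (Fin n → ℤ) λ x* → Base x* × Stuck d x* × Stuck c x*
      search {x} x∈B (acc smaller) with improve-or-stuck x∈B
      ... | inj₁ (x′ , x′∈B , x′<x) = search x′∈B (smaller (∣∣-<-nonneg (excess-nonneg x′) x′<x))
      ... | inj₂ (stuck-d , stuck-c) = x , x∈B , stuck-d , stuck-c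

    -- The dual objective p(X) − b(Y) − d̃(X) + c̃(Y), given a = p(X) and e = p(S∖Y).
    objective : ℤ → ℤ → Subset n → Subset n → ℤ
    objective a e X Y = ((a - (pS - e)) - sumOver d X) + sumOver c Y

    objective-mono : ∀ {a a′ e e′} X Y → a ≤ a′ → e ≤ e′ → objective a e X Y ≤ objective a′ e′ X Y
    objective-mono X Y a≤a′ e≤e′ =
      +-monoˡ-≤ (sumOver c Y) (+-monoˡ-≤ (- sumOver d X)
        (+-mono-≤ a≤a′ (neg-mono-≤ (+-monoʳ-≤ pS (neg-mono-≤ e≤e′)))))

    -- With p replaced by x̃ for x ∈ B, the objective splits over coordinates:
    -- x − d on X, c − x on Y and 0 elsewhere.
    coordinatewise : (Fin n → ℤ) → Subset n → Subset n → Fin n → ℤ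
    coordinatewise x X Y = piecewise X Y (λ i → x i - d i) (λ i → c i - x i)

    objective-at : ∀ {x} → Base x → ∀ X Y → Empty (X ∩ Y) →
      objective (sumOver x X) (sumOver x (∁ Y)) X Y ≡ sumOver (coordinatewise x X Y) ⊤
    objective-at {x} (total , _) X Y disjoint = begin
      ((x̃ X - (pS - x̃ (∁ Y))) - sumOver d X) + sumOver c Y
        ≡⟨ cong (λ q → ((x̃ X - (q - x̃ (∁ Y))) - sumOver d X) + sumOver c Y)
                (trans (sym total) (sym (sumOver-∁ x Y))) ⟩
      ((x̃ X - ((x̃ Y + x̃ (∁ Y)) - x̃ (∁ Y))) - sumOver d X) + sumOver c Y
        ≡⟨ regroup (x̃ X) (x̃ Y) (x̃ (∁ Y)) (sumOver d X) (sumOver c Y) ⟩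
      (x̃ X - sumOver d X) + (sumOver c Y - x̃ Y)
        ≡⟨ sym (cong₂ _+_ (sumOver-diff x d X) (sumOver-diff c x Y)) ⟩
      sumOver (λ i → x i - d i) X + sumOver (λ i → c i - x i) Y
        ≡⟨ sumOver-piecewise X Y _ _ disjoint ⟩
      sumOver (coordinatewise x X Y) ⊤ ∎
      where
      open ≡-Reasoning
      x̃ : Subset n → ℤ
      x̃ = sumOver x
      regroup : ∀ a u v δ γ → ((a - ((u + v) - v)) - δ) + γ ≡ (a - δ) + (γ - u)
      regroup = solve-∀

    weak-duality : ∀ {x y m} → Base x → InBox c d y → IsDualValue p pS c d m → m ≤ dist1 x y
    weak-duality {x} {y} x∈B y∈box (X , Y , a , e , disjoint , pX , p∁Y , refl) = begin
      objective a e X Y                              ≤⟨ objective-mono X Y (lower X a pX) (lower (∁ Y) e p∁Y) ⟩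
      objective (sumOver x X) (sumOver x (∁ Y)) X Y  ≡⟨ objective-at x∈B X Y disjoint ⟩
      sumOver (coordinatewise x X Y) ⊤               ≤⟨ sumOver-mono _ _ ⊤ bound ⟩
      dist1 x y                                      ∎
      where
      open ≤-Reasoning
      lower : ∀ Z a → p Z ≡ just a → a ≤ sumOver x Z
      lower = proj₂ x∈B
      bound : ∀ i → coordinatewise x X Y i ≤ + ∣ x i - y i ∣
      bound i with piecewise-view X Y (λ i → x i - d i) (λ i → c i - x i) i
      ... | inj₁ (_ , value) = begin
        coordinatewise x X Y i ≡⟨ value ⟩
        x i - d i              ≤⟨ +-monoʳ-≤ (x i) (neg-mono-≤ (proj₂ (y∈box i))) ⟩
        x i - y i              ≤⟨ i≤+∣i∣ (x i - y i) ⟩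
        + ∣ x i - y i ∣        ∎
      ... | inj₂ (inj₁ (_ , value)) = begin
        coordinatewise x X Y i ≡⟨ value ⟩
        c i - x i              ≤⟨ +-monoˡ-≤ (- x i) (proj₁ (y∈box i)) ⟩
        y i - x i              ≤⟨ i≤+∣i∣ (y i - x i) ⟩
        + ∣ y i - x i ∣        ≡⟨ cong +_ (∣i-j∣≡∣j-i∣ (y i) (x i)) ⟩
        + ∣ x i - y i ∣        ∎
      ... | inj₂ (inj₂ (_ , _ , value)) = begin
        coordinatewise x X Y i ≡⟨ value ⟩
        0ℤ                     ≤⟨ +≤+ z≤n ⟩
        + ∣ x i - y i ∣        ∎

    dual-pair : ∀ {x} → Base x → ∀ X W → Tight x X → Tight x W →
      (∀ i → d i < x i → i ∈ X) → (∀ i → x i < d i → i ∉ X) →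
      (∀ i → c i < x i → i ∈ W) → (∀ i → x i < c i → i ∉ W) →
      IsDualValue p pS c d (excess x)
    dual-pair {x} x∈B X W tight-X tight-W above-d below-d above-c below-c =
      X , ∁ U , sumOver x X , sumOver x (∁ (∁ U)) , disjoint , tight-X ,
      subst (Tight x) (sym (∁-involutive U)) (proj₂ (tight-∩∪ x∈B tight-X tight-W)) ,
      trans (objective-at x∈B X (∁ U) disjoint) (sumOver-cong _ _ ⊤ matches)
      where
      U : Subset n
      U = X ∪ W
      disjoint : Empty (X ∩ ∁ U)
      disjoint (i , i∈X∩∁U) =
        let (i∈X , i∈∁U) = x∈p∩q⁻ X (∁ U) i∈X∩∁U in x∈∁p⇒x∉p i∈∁U (x∈p∪q⁺ (inj₁ i∈X))
      -- On X the coordinate is at least d, outside U at most c, and on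
      -- U ∖ X (⊆ W) between c and d; in each case the contribution is G i (x i).
      matches : ∀ i → coordinatewise x X (∁ U) i ≡ G i (x i)
      matches i with piecewise-view X (∁ U) (λ i → x i - d i) (λ i → c i - x i) i
      ... | inj₁ (i∈X , value) =
        trans value (sym (gap-above (c≤d i) (≮⇒≥ λ xi<di → below-d i xi<di i∈X)))
      ... | inj₂ (inj₁ (i∈∁U , value)) =
        trans value (sym (gap-below (c≤d i) (≮⇒≥ λ ci<xi →
          x∈∁p⇒x∉p i∈∁U (x∈p∪q⁺ (inj₂ (above-c i ci<xi))))))
      ... | inj₂ (inj₂ (i∉X , i∉∁U , value)) with x∈p∪q⁻ X W (x∉∁p⇒x∈p i∉∁U)
      ...   | inj₁ i∈X = ⊥-elim (i∉X i∈X)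
      ...   | inj₂ i∈W = trans value (sym (gap-inside (c≤d i)
                (≮⇒≥ λ xi<ci → below-c i xi<ci i∈W) (≮⇒≥ λ di<xi → i∉X (above-d i di<xi))))

    -- Strong duality at a stuck point: separate the coordinates above and
    -- below d, and above and below c, by tight sets.
    certificate : ∀ {x} → Base x → Stuck d x → Stuck c x → IsDualValue p pS c d (excess x)
    certificate {x} x∈B stuck-d stuck-c =
      let (X , tight-X , above-d , below-d) = separate-at d stuck-d
          (W , tight-W , above-c , below-c) = separate-at c stuck-c
      in dual-pair x∈B X W tight-X tight-W above-d below-d above-c below-c
      where
      separate-at : ∀ l → Stuck l x →
        Σ (Subset n) λ Z → Tight x Z × (∀ i → l i < x i → i ∈ Z) × (∀ i → x i < l i → i ∉ Z)
      separate-at l stuck = separate (Tight x) (tight-⊥ x) (tight-⊤ x∈B)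
        (λ tA tB → proj₁ (tight-∩∪ x∈B tA tB)) (λ tA tB → proj₂ (tight-∩∪ x∈B tA tB))
        (λ i → l i <? x i) (λ i → x i <? l i) stuck

proposition7p2 : (k : ℕ) (p : Subset (suc k) → ℤ-∞) (pS : ℤ) →
    Supermodular p → p ⊥ ≡ just 0ℤ → p ⊤ ≡ just pS →
    Σ (Fin (suc k) → ℤ) (λ x → InBase p pS x) →
    (c d : Fin (suc k) → ℤ) → (∀ i → c i ≤ d i) →
    Σ ℤ λ m →
      (IsPrimalValue p pS c d m × (∀ m′ → IsPrimalValue p pS c d m′ → m ≤ m′)) ×
      (IsDualValue p pS c d m × (∀ m′ → IsDualValue p pS c d m′ → m′ ≤ m))
proposition7p2 k p pS supermodular p⊥ p⊤ (x₀ , x₀∈B) c d c≤d =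
  let (x , x∈B , stuck-d , stuck-c) = descent x₀∈B
      optimal-dual = certificate x∈B stuck-d stuck-c
  in excess x ,
     ( (x , nearest x , x∈B , nearest-in-box x , refl)
     , λ { _ (x′ , y′ , x′∈B , y′∈box , refl) → weak-duality x′∈B y′∈box optimal-dual } ) ,
     ( optimal-dual
     , λ _ dual → weak-duality x∈B (nearest-in-box x) dual )
  where
  open BasePolyhedron p pS supermodular p⊥ p⊤
  open Box c d c≤d
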